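{- For every integer $t \ge 2$ there exists a real constant $c_t > 1$ such that for infinitely many integers $d \ge 2$ there exists a multigraph $G$ with $\max\{\Delta_t(G), a(G)\} = d$ and $a_t(G) \ge c_t d$.
   Context: A multigraph may have parallel edges but no loops. For a multigraph $G$ and a function $f : V(G) \to \mathbb{Z}_{\ge 2}$, a degree-$f$ forest of $G$ is a spanning subgraph that is a forest in which every vertex $v$ has degree at most $f(v)$. The degree-$f$ arboricity $a_f(G)$ is the minimum number of colors in an edge-coloring of $G$ in which every color class is a degree-$f$ forest; $a_t(G)$ denotes $a_f(G)$ for the constant function $f \equiv t$. The arboricity $a(G)$ is the minimum number of colors in an edge-coloring of $G$ in which each color class is a forest. $\Delta_f(G) = \max_{v \in V(G)} \lceil d(v)/f(v) \rceil$, where $d(v)$ is the degree of $v$ (counting parallel edges); $\Delta_t(G)$ denotes this for $f \equiv t$. -}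

module Defs where

open import Data.Nat using (ℕ; zero; suc; _+_; _≤_; _⊔_; _/_)
open import Data.Fin using (Fin; zero; suc; inject₁; fromℕ; _≟_)
open import Data.Fin.Properties using () renaming (_≟_ to _≟F_)
open import Data.Bool using (Bool; _∨_; _∧_)
open import Data.List using (List; length; filterᵇ; map; foldr; allFin)
open import Data.Product using (Σ; _×_; _,_; proj₁; proj₂)
open import Data.Sum using (_⊎_)
open import Relation.Nullary using (¬_)
open import Relation.Nullary.Decidable using (⌊_⌋)
open import Relation.Binary.PropositionalEquality using (_≡_; _≢_)
open import Function.Definitions using (Injective)

-- A finite loopless multigraph: vertices Fin n, edges Fin m (so parallel
-- edges are distinct edge labels with equal endpoint pairs).
record Multigraph : Set where
  field
    n     : ℕ
    m     : ℕ
    ends  : Fin m → Fin n × Fin n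
    noLoop : (e : Fin m) → proj₁ (ends e) ≢ proj₂ (ends e)
open Multigraph public

incidentᵇ : (G : Multigraph) → Fin (m G) → Fin (n G) → Bool
incidentᵇ G e v = ⌊ proj₁ (ends G e) ≟ v ⌋ ∨ ⌊ proj₂ (ends G e) ≟ v ⌋

degree : (G : Multigraph) → Fin (n G) → ℕ
degree G v = length (filterᵇ (λ e → incidentᵇ G e v) (allFin (m G)))

-- ⌈ d / t ⌉ (only used with t ≥ 2; value for t = 0 is irrelevant)
ceilDiv : ℕ → ℕ → ℕ
ceilDiv d zero = zero
ceilDiv d (suc t) = (d + t) / suc t

Δ : ℕ → Multigraph → ℕ
Δ t G = foldr _⊔_ 0 (map (λ v → ceilDiv (degree G v) t) (allFin (n G)))

Joins : (G : Multigraph) → Fin (m G) → Fin (n G) → Fin (n G) → Set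
Joins G e u v = (ends G e ≡ (u , v)) ⊎ (ends G e ≡ (v , u))

record Cycle (G : Multigraph) (S : Fin (m G) → Set) : Set where
  field
    k      : ℕ
    k≥2    : 2 ≤ k
    vs     : Fin (suc k) → Fin (n G)
    es     : Fin k → Fin (m G)
    vsInj  : Injective _≡_ _≡_ (λ (i : Fin k) → vs (inject₁ i))
    closed : vs (fromℕ k) ≡ vs zero
    esInj  : Injective _≡_ _≡_ es
    esIn   : (i : Fin k) → S (es i)
    esJoin : (i : Fin k) → Joins G (es i) (vs (inject₁ i)) (vs (suc i))

Colouring : Multigraph → ℕ → Set
Colouring G k = Fin (m G) → Fin k

ClassForest : (G : Multigraph) {k : ℕ} → Colouring G k → Fin k → Set
ClassForest G c i = ¬ Cycle G (λ e → c e ≡ i)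

classDegree : (G : Multigraph) {k : ℕ} → Colouring G k → Fin k → Fin (n G) → ℕ
classDegree G c i v =
  length (filterᵇ (λ e → ⌊ c e ≟ i ⌋ ∧ incidentᵇ G e v) (allFin (m G)))

ForestColouring : (G : Multigraph) (k : ℕ) → Set
ForestColouring G k = Σ (Colouring G k) λ c → (i : Fin k) → ClassForest G c i

DegForestColouring : ℕ → (G : Multigraph) (k : ℕ) → Set
DegForestColouring t G k =
  Σ (Colouring G k) λ c → (i : Fin k) →
    ClassForest G c i × ((v : Fin (n G)) → classDegree G c i v ≤ t)

IsMin : (ℕ → Set) → ℕ → Set
IsMin P k = P k × ((j : ℕ) → P j → k ≤ j)

IsArboricity : Multigraph → ℕ → Set
IsArboricity G = IsMin (ForestColouring G)

IsDegArboricity : ℕ → Multigraph → ℕ → Set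
IsDegArboricity t G = IsMin (DegForestColouring t G)

{-# OPTIONS --safe #-}
module Submission where

-- Let t = r + 1. Take a triangle whose sides have multiplicity s and attach r pendant leaves to
-- each corner, each by 2s parallel edges. Every corner has degree 2st, so Δ_t = 2s, and orienting
-- edges along a potential splits the graph into 2s forests, so d = max {Δ_t, a} = 2s. A degree-t
-- forest contains at most one edge of each parallel class and at most two sides of the triangle:
-- A ≤ 2 side edges and B ≤ 3r pendant edges. Summing the degree bound over the corners gives
-- 2A + B ≤ 3t, hence A + B ≤ 3r + 1. As the graph has 3s(2r + 1) edges, (3r + 1) a_t ≥ 3s(2r + 1),
-- that is (6r + 3) d ≤ (6r + 2) a_t.

open import Defs
open import Data.Bool using (Bool; true; false; _∧_; _∨_)
open import Data.Bool.Properties using (∨-identityʳ)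
open import Data.Empty using (⊥; ⊥-elim)
open import Data.Fin
  using (Fin; zero; suc; inject₁; fromℕ; fromℕ<; toℕ; _↑ˡ_; _↑ʳ_; combine; remQuot; splitAt; join; _≟_)
open import Data.Fin.Patterns using (0F; 1F; 2F)
open import Data.Fin.Properties
  using ( suc-injective; toℕ-injective; toℕ-fromℕ<; toℕ-inject₁; toℕ-fromℕ; any?; all?; injective⇒≤
        ; ↑ˡ-injective; ↑ʳ-injective; remQuot-combine; combine-remQuot; splitAt-join; join-splitAt
        ; splitAt-↑ˡ; splitAt-↑ʳ)
open import Data.List using (length; filterᵇ; allFin; foldr; tabulate)
open import Data.List.Properties using (map-tabulate)
open import Data.Maybe using (Maybe; just; nothing)
open import Data.Maybe.Properties using (just-injective)
open import Data.Nat
  using (ℕ; zero; suc; _+_; _*_; _⊔_; _/_; _≤_; _<_; _≤?_; z≤n; s≤s; s≤s⁻¹)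
open import Data.Nat.DivMod using (m<n*o⇒m/o<n; m*n/n≡m; /-monoˡ-≤)
open import Data.Nat.Properties
  using ( ≤-refl; ≤-trans; ≤-reflexive; ≤-antisym; <-trans; <-irrefl; <-≤-trans; ≮⇒≥; n≤1+n; n<1+n
        ; m<n⇒m<1+n; 1+n≢n; +-assoc; +-comm; +-identityʳ; *-comm; *-zeroʳ; *-identityʳ; *-suc
        ; +-mono-≤; +-monoˡ-≤; m≤m+n; m≤n+m; m≤m*n; ⊔-lub; m≤m⊔n; m≤n⊔m; m≥n⇒m⊔n≡m; anyUpTo?
        ; +-*-semiring; module ≤-Reasoning)
open import Algebra.Properties.Semiring.Sum +-*-semiring
  using (sum; sum-syntax; sum-cong-≗; ∑-comm; ∑-distrib-+; *-distribˡ-sum; *-distribʳ-sum)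
open import Data.Nat.Tactic.RingSolver using (solve-∀)
open import Data.Product using (Σ; ∃; _×_; _,_; proj₁; proj₂; uncurry)
open import Data.Product.Properties using (,-injective; ≡-dec)
open import Data.Sum using (_⊎_; inj₁; inj₂; [_,_]′)
open import Data.Vec.Functional using (_∷_)
open import Function using (_∘_; id; const)
open import Function.Bundles using (mk⇔)
open import Function.Definitions using (Injective)
open import Relation.Binary.Definitions using (_Respects_)
open import Relation.Binary.PropositionalEquality
open import Relation.Nullary using (Dec; yes; no; ¬_)
open import Relation.Nullary.Decidable
  using (⌊_⌋; isYes≗does; does-⇔; map′; _×-dec_; _⊎-dec_; _→-dec_; ¬?)
open import Relation.Unary using (Decidable)

-- Finite sums and counting

fromBool : Bool → ℕ
fromBool true  = 1
fromBool false = 0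

fromBool-∧ : ∀ a b → fromBool (a ∧ b) ≡ fromBool a * fromBool b
fromBool-∧ true  true  = refl
fromBool-∧ true  false = refl
fromBool-∧ false _     = refl

fromBool-∧-≤ : ∀ a b → fromBool (a ∧ b) ≤ fromBool a
fromBool-∧-≤ true  true  = s≤s z≤n
fromBool-∧-≤ true  false = z≤n
fromBool-∧-≤ false _     = z≤n

count : ∀ {n} → (Fin n → Bool) → ℕ
count p = sum (fromBool ∘ p)

∑-const : ∀ n c → ∑[ i < n ] c ≡ n * c
∑-const zero    c = refl
∑-const (suc n) c = cong (c +_) (∑-const n c)

∑-zero : ∀ n → ∑[ i < n ] 0 ≡ 0
∑-zero n = trans (∑-const n 0) (*-zeroʳ n)

∑-mono : ∀ {n} {f g : Fin n → ℕ} → (∀ i → f i ≤ g i) → sum f ≤ sum g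
∑-mono {zero}  f≤g = z≤n
∑-mono {suc n} f≤g = +-mono-≤ (f≤g zero) (∑-mono (f≤g ∘ suc))

∑-↑ : ∀ a b (f : Fin (a + b) → ℕ) → sum f ≡ ∑[ i < a ] f (i ↑ˡ b) + ∑[ j < b ] f (a ↑ʳ j)
∑-↑ zero    b f = refl
∑-↑ (suc a) b f = trans (cong (f zero +_) (∑-↑ a b (f ∘ suc))) (sym (+-assoc (f zero) _ _))

∑-combine : ∀ a b (f : Fin (a * b) → ℕ) → sum f ≡ ∑[ i < a ] ∑[ j < b ] f (combine i j)
∑-combine zero    b f = refl
∑-combine (suc a) b f = trans (∑-↑ b (a * b) f) (cong (∑[ j < b ] f (j ↑ˡ (a * b)) +_) (∑-combine a b (f ∘ (b ↑ʳ_))))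

count-true : ∀ n → count {n} (λ _ → true) ≡ n
count-true n = trans (∑-const n 1) (*-identityʳ n)

length-filterᵇ-allFin : ∀ {n} (p : Fin n → Bool) → length (filterᵇ p (allFin n)) ≡ count p
length-filterᵇ-allFin p = go p id
  where
  go : ∀ {A : Set} {n} (p : A → Bool) (f : Fin n → A) → length (filterᵇ p (tabulate f)) ≡ count (p ∘ f)
  go {n = zero}  p f = refl
  go {n = suc n} p f with p (f zero)
  ... | true  = cong suc (go p (f ∘ suc))
  ... | false = go p (f ∘ suc)

count≤1 : ∀ {n} (p : Fin n → Bool) → (∀ {i j} → p i ≡ true → p j ≡ true → i ≡ j) → count p ≤ 1
count≤1 {zero}  p unique = z≤n
count≤1 {suc n} p unique with p zero in p0
... | true  = s≤s (≤-reflexive (trans (sum-cong-≗ none) (∑-zero n)))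
  where
  none : ∀ i → fromBool (p (suc i)) ≡ 0
  none i with p (suc i) in pi
  ... | true  with () ← unique p0 pi
  ... | false = refl
... | false = count≤1 (p ∘ suc) λ pi pj → suc-injective (unique pi pj)

0<count⇒∃ : ∀ {n} (p : Fin n → Bool) → 0 < count p → ∃ λ i → p i ≡ true
0<count⇒∃ {suc n} p pos with p zero in p0
... | true  = zero , p0
... | false with i , pi ← 0<count⇒∃ (p ∘ suc) pos = suc i , pi

count-∧ : ∀ {n} (p : Fin n → Bool) β → count (λ i → p i ∧ β) ≡ fromBool β * count p
count-∧ p β = begin
  count (λ i → p i ∧ β)
    ≡⟨ sum-cong-≗ (λ i → trans (fromBool-∧ (p i) β) (*-comm (fromBool (p i)) (fromBool β))) ⟩
  ∑[ i < _ ] (fromBool β * fromBool (p i))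
    ≡⟨ *-distribˡ-sum (fromBool β) (fromBool ∘ p) ⟨
  fromBool β * count p ∎
  where open ≡-Reasoning

⌊≟⌋-injective : ∀ {a b} {f : Fin a → Fin b} → Injective _≡_ _≡_ f → ∀ x y → ⌊ f x ≟ f y ⌋ ≡ ⌊ x ≟ y ⌋
⌊≟⌋-injective {f = f} inj x y =
  trans (isYes≗does _) (trans (does-⇔ (mk⇔ inj (cong f)) (f x ≟ f y) (x ≟ y)) (sym (isYes≗does _)))

⌊≟⌋-sym : ∀ {n} (x y : Fin n) → ⌊ x ≟ y ⌋ ≡ ⌊ y ≟ x ⌋
⌊≟⌋-sym x y = trans (isYes≗does _) (trans (does-⇔ (mk⇔ sym sym) (x ≟ y) (y ≟ x)) (sym (isYes≗does _)))

⌊≟⌋⇒≡ : ∀ {n} {x y : Fin n} → ⌊ x ≟ y ⌋ ≡ true → x ≡ y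
⌊≟⌋⇒≡ {x = x} {y} p with x ≟ y
... | yes x≡y = x≡y

count-≟ : ∀ {n} (x : Fin n) → count (λ i → ⌊ i ≟ x ⌋) ≡ 1
count-≟ {suc n} zero    = cong suc (∑-zero n)
count-≟ {suc n} (suc x) =
  trans (sum-cong-≗ λ i → cong fromBool (⌊≟⌋-injective suc-injective i x)) (count-≟ x)

count-≟′ : ∀ {n} (x : Fin n) → count (λ i → ⌊ x ≟ i ⌋) ≡ 1
count-≟′ x = trans (sum-cong-≗ λ i → cong fromBool (⌊≟⌋-sym x i)) (count-≟ x)

∑-δ : ∀ {n} (j : Fin n) (f : Fin n → ℕ) → ∑[ i < n ] (fromBool ⌊ i ≟ j ⌋ * f i) ≡ f j
∑-δ {suc n} zero    f = trans (cong₂ _+_ (+-identityʳ (f zero)) (∑-zero n)) (+-identityʳ (f zero))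
∑-δ {suc n} (suc j) f =
  trans (sum-cong-≗ λ i → cong (λ b → fromBool b * f (suc i)) (⌊≟⌋-injective suc-injective i j)) (∑-δ j (f ∘ suc))

at-most-two : ∀ {a b c} → a ≤ 1 → b ≤ 1 → c ≤ 1 → ¬ (0 < a × 0 < b × 0 < c) → a + (b + (c + 0)) ≤ 2
at-most-two z≤n       b≤1       c≤1       _ = +-mono-≤ b≤1 (+-mono-≤ c≤1 z≤n)
at-most-two (s≤s z≤n) z≤n       c≤1       _ = s≤s (+-mono-≤ c≤1 z≤n)
at-most-two (s≤s z≤n) (s≤s z≤n) z≤n       _ = ≤-refl
at-most-two (s≤s z≤n) (s≤s z≤n) (s≤s z≤n) not-all = ⊥-elim (not-all (s≤s z≤n , s≤s z≤n , s≤s z≤n))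

edge-budget : ∀ {a b n} → a ≤ 2 → b ≤ n → 2 * a + b ≤ 3 + n → a + b ≤ 1 + n
edge-budget z≤n             b≤n _                   = ≤-trans b≤n (n≤1+n _)
edge-budget (s≤s z≤n)       b≤n _                   = s≤s b≤n
edge-budget (s≤s (s≤s z≤n)) _   (s≤s (s≤s (s≤s 1+b≤n))) = s≤s 1+b≤n

-- Degrees, cycles and colourings

subDegree : (G : Multigraph) → (Fin (m G) → Bool) → Fin (n G) → ℕ
subDegree G q v = count (λ e → q e ∧ incidentᵇ G e v)

degree≡subDegree : ∀ G v → degree G v ≡ subDegree G (λ _ → true) v
degree≡subDegree G v = length-filterᵇ-allFin (λ e → incidentᵇ G e v)

classDegree≡subDegree : ∀ G {k} (c : Colouring G k) i v → classDegree G c i v ≡ subDegree G (λ e → ⌊ c e ≟ i ⌋) v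
classDegree≡subDegree G c i v = length-filterᵇ-allFin (λ e → ⌊ c e ≟ i ⌋ ∧ incidentᵇ G e v)

Cycle-map : ∀ {G} {S S′ : Fin (m G) → Set} → (∀ {e} → S e → S′ e) → Cycle G S → Cycle G S′
Cycle-map S⊆S′ C = record { Cycle C ; esIn = S⊆S′ ∘ Cycle.esIn C }

module _ (G : Multigraph) where

  ends-distinct : ∀ {e u v} → ends G e ≡ (u , v) → u ≢ v
  ends-distinct {e} refl = noLoop G e

  distinct-first-ends : ∀ {e e′ u v u′ v′} → ends G e ≡ (u , v) → ends G e′ ≡ (u′ , v′) → u ≢ u′ → e ≢ e′
  distinct-first-ends refl refl u≢u′ refl = u≢u′ refl

  parallel⇒Cycle : ∀ {S e e′} → ends G e ≡ ends G e′ → e ≢ e′ → S e → S e′ → Cycle G S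
  parallel⇒Cycle {S} {e} {e′} same e≢e′ Se Se′ = record
    { k = 2 ; k≥2 = ≤-refl ; vs = vs ; es = es ; vsInj = vs-inj ; closed = refl ; esInj = es-inj
    ; esIn = λ { 0F → Se ; 1F → Se′ } ; esJoin = λ { 0F → inj₁ refl ; 1F → inj₂ (sym same) } }
    where
    u = proj₁ (ends G e)
    v = proj₂ (ends G e)
    vs : Fin 3 → Fin (n G)
    vs 0F = u
    vs 1F = v
    vs 2F = u
    es : Fin 2 → Fin (m G)
    es 0F = e
    es 1F = e′
    vs-inj : ∀ {i j : Fin 2} → vs (inject₁ i) ≡ vs (inject₁ j) → i ≡ j
    vs-inj {0F} {0F} _ = refl
    vs-inj {0F} {1F} p = ⊥-elim (noLoop G e p)
    vs-inj {1F} {0F} p = ⊥-elim (noLoop G e (sym p))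
    vs-inj {1F} {1F} _ = refl
    es-inj : ∀ {i j : Fin 2} → es i ≡ es j → i ≡ j
    es-inj {0F} {0F} _ = refl
    es-inj {0F} {1F} p = ⊥-elim (e≢e′ p)
    es-inj {1F} {0F} p = ⊥-elim (e≢e′ (sym p))
    es-inj {1F} {1F} _ = refl

  triangle⇒Cycle : ∀ {S e₀ e₁ e₂ a b c} → ends G e₀ ≡ (a , b) → ends G e₁ ≡ (b , c) → ends G e₂ ≡ (c , a) →
                   S e₀ → S e₁ → S e₂ → Cycle G S
  triangle⇒Cycle {S} {e₀} {e₁} {e₂} {a} {b} {c} ab bc ca S₀ S₁ S₂ = record
    { k = 3 ; k≥2 = s≤s (s≤s z≤n) ; vs = vs ; es = es ; vsInj = vs-inj ; closed = refl ; esInj = es-inj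
    ; esIn = λ { 0F → S₀ ; 1F → S₁ ; 2F → S₂ } ; esJoin = λ { 0F → inj₁ ab ; 1F → inj₁ bc ; 2F → inj₁ ca } }
    where
    a≢b = ends-distinct ab
    b≢c = ends-distinct bc
    c≢a = ends-distinct ca
    vs : Fin 4 → Fin (n G)
    vs 0F = a
    vs 1F = b
    vs 2F = c
    vs (suc (suc (suc _))) = a
    es : Fin 3 → Fin (m G)
    es 0F = e₀
    es 1F = e₁
    es 2F = e₂
    vs-inj : ∀ {i j : Fin 3} → vs (inject₁ i) ≡ vs (inject₁ j) → i ≡ j
    vs-inj {0F} {0F} _ = refl
    vs-inj {0F} {1F} p = ⊥-elim (a≢b p)
    vs-inj {0F} {2F} p = ⊥-elim (c≢a (sym p))
    vs-inj {1F} {0F} p = ⊥-elim (a≢b (sym p))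
    vs-inj {1F} {1F} _ = refl
    vs-inj {1F} {2F} p = ⊥-elim (b≢c p)
    vs-inj {2F} {0F} p = ⊥-elim (c≢a p)
    vs-inj {2F} {1F} p = ⊥-elim (b≢c (sym p))
    vs-inj {2F} {2F} _ = refl
    es-inj : ∀ {i j : Fin 3} → es i ≡ es j → i ≡ j
    es-inj {0F} {0F} _ = refl
    es-inj {0F} {1F} p = ⊥-elim (distinct-first-ends ab bc a≢b p)
    es-inj {0F} {2F} p = ⊥-elim (distinct-first-ends ab ca (c≢a ∘ sym) p)
    es-inj {1F} {0F} p = ⊥-elim (distinct-first-ends bc ab (a≢b ∘ sym) p)
    es-inj {1F} {1F} _ = refl
    es-inj {1F} {2F} p = ⊥-elim (distinct-first-ends bc ca b≢c p)
    es-inj {2F} {0F} p = ⊥-elim (distinct-first-ends ca ab c≢a p)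
    es-inj {2F} {1F} p = ⊥-elim (distinct-first-ends ca bc (b≢c ∘ sym) p)
    es-inj {2F} {2F} _ = refl

  module _ {S : Fin (m G) → Set} (φ : Fin (n G) → ℕ) (lower upper : Fin (m G) → Fin (n G))
           (lower-upper : ∀ e → Joins G e (lower e) (upper e))
           (φ-ascends : ∀ e → φ (lower e) < φ (upper e))
           (lower-injective : ∀ {e e′} → S e → S e′ → lower e ≡ lower e′ → e ≡ e′) where

    private
      orient : ∀ {e x y} → Joins G e x y → (lower e ≡ x × φ x < φ y) ⊎ (lower e ≡ y × φ y < φ x)
      orient {e} xy with xy | lower-upper e
      ... | inj₁ p | inj₁ q with refl , refl ← ,-injective (trans (sym q) p) = inj₁ (refl , φ-ascends e)
      ... | inj₁ p | inj₂ q with refl , refl ← ,-injective (trans (sym q) p) = inj₂ (refl , φ-ascends e)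
      ... | inj₂ p | inj₁ q with refl , refl ← ,-injective (trans (sym q) p) = inj₂ (refl , φ-ascends e)
      ... | inj₂ p | inj₂ q with refl , refl ← ,-injective (trans (sym q) p) = inj₁ (refl , φ-ascends e)

    -- Along a cycle, a backward edge (lower end last) cannot be followed by a forward one, as both
    -- would have the same lower end; so the edges run forwards, then backwards, and closing the
    -- cycle contradicts each possibility.
    potential⇒acyclic : ¬ Cycle G S
    potential⇒acyclic C@record { k≥2 = s≤s (s≤s {n = k-2} _) } = closing (walk (suc k-2) ≤-refl)
      where
      open Cycle C
      v : (j : ℕ) → .(j < suc k) → Fin (n G)
      v j p = vs (fromℕ< p)
      e : (j : ℕ) → .(j < k) → Fin (m G)
      e j p = es (fromℕ< p)
      e-joins : ∀ j (p : j < k) → Joins G (e j p) (v j (m<n⇒m<1+n p)) (v (suc j) (s≤s p))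
      e-joins j p = subst (λ i → Joins G (e j p) (vs i) (v (suc j) (s≤s p))) inject₁-fromℕ< (esJoin (fromℕ< p))
        where
        inject₁-fromℕ< : inject₁ (fromℕ< p) ≡ fromℕ< (m<n⇒m<1+n p)
        inject₁-fromℕ< = toℕ-injective (trans (toℕ-inject₁ _) (trans (toℕ-fromℕ< p) (sym (toℕ-fromℕ< _))))
      e-lower-injective : ∀ i j .(p : i < k) .(q : j < k) → lower (e i p) ≡ lower (e j q) → i ≡ j
      e-lower-injective i j p q same =
        trans (sym (toℕ-fromℕ< p)) (trans (cong toℕ (esInj (lower-injective (esIn _) (esIn _) same))) (toℕ-fromℕ< q))
      v₀ = v 0 (s≤s z≤n)
      Forward Backward : ∀ j → j < k → Set
      Forward j p = lower (e 0 (s≤s z≤n)) ≡ v₀ × φ v₀ < φ (v (suc j) (s≤s p))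
      Backward j p = lower (e j p) ≡ v (suc j) (s≤s p) × (φ (v (suc j) (s≤s p)) < φ v₀ ⊎ lower (e 0 (s≤s z≤n)) ≡ v₀)
      walk : ∀ j (p : j < k) → Forward j p ⊎ Backward j p
      walk zero p with orient (e-joins 0 p)
      ... | inj₁ (low , up)   = inj₁ (low , up)
      ... | inj₂ (low , down) = inj₂ (low , inj₁ down)
      walk (suc j) p with walk j (<-trans (n<1+n j) p) | orient (e-joins (suc j) p)
      ... | inj₁ (low₀ , up₀)     | inj₁ (_ , up)     = inj₁ (low₀ , <-trans up₀ up)
      ... | inj₁ (low₀ , _)       | inj₂ (low , _)    = inj₂ (low , inj₂ low₀)
      ... | inj₂ (lowⱼ , _)       | inj₁ (low , _)    = ⊥-elim (1+n≢n (e-lower-injective _ _ p _ (trans low (sym lowⱼ))))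
      ... | inj₂ (_ , inj₁ down₀) | inj₂ (low , down) = inj₂ (low , inj₁ (<-trans down down₀))
      ... | inj₂ (_ , inj₂ low₀)  | inj₂ (low , _)    = inj₂ (low , inj₂ low₀)
      vₖ≡v₀ : v k ≤-refl ≡ v₀
      vₖ≡v₀ = trans (cong vs (toℕ-injective (trans (toℕ-fromℕ< ≤-refl) (sym (toℕ-fromℕ k))))) closed
      closing : Forward (suc k-2) ≤-refl ⊎ Backward (suc k-2) ≤-refl → ⊥
      closing (inj₁ (_ , up))          = <-irrefl (cong φ (sym vₖ≡v₀)) up
      closing (inj₂ (_ , inj₁ down))   = <-irrefl (cong φ vₖ≡v₀) down
      closing (inj₂ (low , inj₂ low₀)) with () ← e-lower-injective (suc k-2) 0 ≤-refl (s≤s z≤n) (trans low (trans vₖ≡v₀ (sym low₀)))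

colourClasses-partition : ∀ G {K} (c : Colouring G K) → ∑[ i < K ] count (λ e → ⌊ c e ≟ i ⌋) ≡ m G
colourClasses-partition G {K} c = begin
  ∑[ i < K ] ∑[ e < m G ] fromBool ⌊ c e ≟ i ⌋ ≡⟨ ∑-comm (λ i e → fromBool ⌊ c e ≟ i ⌋) ⟩
  ∑[ e < m G ] count (λ i → ⌊ c e ≟ i ⌋)       ≡⟨ sum-cong-≗ (λ e → count-≟′ (c e)) ⟩
  ∑[ e < m G ] 1                               ≡⟨ ∑-const (m G) 1 ⟩
  m G * 1                                      ≡⟨ *-identityʳ (m G) ⟩
  m G                                          ∎
  where open ≡-Reasoning

edges≤colours*classSize : ∀ G {K B} (c : Colouring G K) → (∀ i → count (λ e → ⌊ c e ≟ i ⌋) ≤ B) → m G ≤ K * B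
edges≤colours*classSize G {K} {B} c small = begin
  m G                                   ≡⟨ colourClasses-partition G c ⟨
  ∑[ i < K ] count (λ e → ⌊ c e ≟ i ⌋)  ≤⟨ ∑-mono small ⟩
  ∑[ i < K ] B                          ≡⟨ ∑-const K B ⟩
  K * B                                 ∎
  where open ≤-Reasoning

singletonColouring : ∀ {t} G → 1 ≤ t → DegForestColouring t G (m G)
singletonColouring G 1≤t = id , λ i → acyclic i , λ v → ≤-trans (classDegree≤1 i v) 1≤t
  where
  acyclic : ∀ i → ClassForest G id i
  acyclic i record { k≥2 = s≤s (s≤s _) ; esInj = esInj ; esIn = esIn }
    with () ← esInj (trans (esIn 0F) (sym (esIn 1F)))
  classDegree≤1 : ∀ i v → classDegree G id i v ≤ 1
  classDegree≤1 i v = begin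
    classDegree G id i v                      ≡⟨ classDegree≡subDegree G id i v ⟩
    count (λ e → ⌊ e ≟ i ⌋ ∧ incidentᵇ G e v) ≤⟨ ∑-mono (λ e → fromBool-∧-≤ ⌊ e ≟ i ⌋ (incidentᵇ G e v)) ⟩
    count (λ e → ⌊ e ≟ i ⌋)                   ≡⟨ count-≟ i ⟩
    1                                         ∎
    where open ≤-Reasoning

module _ (t : ℕ) (G : Multigraph) where

  private
    Δ≡max : Δ t G ≡ foldr _⊔_ 0 (tabulate (λ v → ceilDiv (degree G v) t))
    Δ≡max = cong (foldr _⊔_ 0) (map-tabulate id (λ v → ceilDiv (degree G v) t))

    max-lub : ∀ {k} (f : Fin k → ℕ) {B} → (∀ i → f i ≤ B) → foldr _⊔_ 0 (tabulate f) ≤ B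
    max-lub {zero}  f f≤B = z≤n
    max-lub {suc k} f f≤B = ⊔-lub (f≤B zero) (max-lub (f ∘ suc) (f≤B ∘ suc))

    max-upper : ∀ {k} (f : Fin k → ℕ) i → f i ≤ foldr _⊔_ 0 (tabulate f)
    max-upper f zero    = m≤m⊔n _ _
    max-upper f (suc i) = ≤-trans (max-upper (f ∘ suc) i) (m≤n⊔m _ _)

  Δ-lub : ∀ {B} → (∀ v → ceilDiv (degree G v) t ≤ B) → Δ t G ≤ B
  Δ-lub bound = subst (_≤ _) (sym Δ≡max) (max-lub _ bound)

  ceilDiv-degree≤Δ : ∀ v → ceilDiv (degree G v) t ≤ Δ t G
  ceilDiv-degree≤Δ v = subst (ceilDiv (degree G v) t ≤_) (sym Δ≡max) (max-upper _ v)

ceilDiv≤ : ∀ {d a} r → d ≤ a * suc r → ceilDiv d (suc r) ≤ a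
ceilDiv≤ {d} {a} r d≤a*t = s≤s⁻¹ (m<n*o⇒m/o<n (begin-strict
  d + r          ≤⟨ +-monoˡ-≤ r d≤a*t ⟩
  a * suc r + r  ≡⟨ +-comm _ r ⟩
  r + a * suc r  <⟨ n<1+n _ ⟩
  suc a * suc r  ∎))
  where open ≤-Reasoning

≤ceilDiv : ∀ {d a} r → a * suc r ≤ d → a ≤ ceilDiv d (suc r)
≤ceilDiv {d} {a} r a*t≤d = begin
  a                    ≡⟨ m*n/n≡m a (suc r) ⟨
  a * suc r / suc r    ≤⟨ /-monoˡ-≤ (suc r) (≤-trans a*t≤d (m≤m+n d r)) ⟩
  (d + r) / suc r      ∎
  where open ≤-Reasoning

-- Constructively, the arboricities of the statement exist as minima because colourability is
-- decidable by exhaustive search.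
module _ {P : ℕ → Set} (P? : Decidable P) where

  private
    least : ∀ u → (∃ λ n → n < u × P n) → Σ ℕ (IsMin P)
    least (suc u) (n , n<1+u , Pn) with anyUpTo? P? u
    ... | yes below = least u below
    ... | no none   = n , Pn , λ j Pj → ≮⇒≥ (λ j<n → none (j , <-≤-trans j<n (s≤s⁻¹ n<1+u) , Pj))

  minimum : ∀ {u} → P u → Σ ℕ (IsMin P)
  minimum {u} Pu = least (suc u) (u , s≤s ≤-refl , Pu)

∃-function? : ∀ {m j} {P : (Fin m → Fin j) → Set} → P Respects _≗_ → Decidable P → Dec (∃ P)
∃-function? {zero} resp P? = map′ (λ p → _ , p) (λ (f , p) → resp (λ ()) p) (P? (λ ()))
∃-function? {suc m} {j} resp P? =
  map′ (λ (a , g , p) → a ∷ g , p) (λ (f , p) → f zero , f ∘ suc , resp head∷tail p)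
       (any? λ a → ∃-function? (λ f≗g → resp (cons-cong f≗g)) (P? ∘ (a ∷_)))
  where
  head∷tail : ∀ {f : Fin (suc m) → Fin j} → f ≗ (f zero ∷ f ∘ suc)
  head∷tail zero    = refl
  head∷tail (suc i) = refl
  cons-cong : ∀ {a} {f g : Fin m → Fin j} → f ≗ g → (a ∷ f) ≗ (a ∷ g)
  cons-cong f≗g zero    = refl
  cons-cong f≗g (suc i) = f≗g i

injective? : ∀ {a b} (f : Fin a → Fin b) → Dec (Injective _≡_ _≡_ f)
injective? f = map′ (λ inj {x} {y} → inj x y) (λ inj x y → inj)
                    (all? λ x → all? λ y → (f x ≟ f y) →-dec (x ≟ y))

module _ (G : Multigraph) {S : Fin (m G) → Set} (S? : Decidable S) where

  private
    Joins? : ∀ e u v → Dec (Joins G e u v)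
    Joins? e u v = ≡-dec _≟_ _≟_ (ends G e) (u , v) ⊎-dec ≡-dec _≟_ _≟_ (ends G e) (v , u)

    IsCycle : ∀ k → (Fin (suc k) → Fin (n G)) → (Fin k → Fin (m G)) → Set
    IsCycle k vs es =
      Injective _≡_ _≡_ (vs ∘ inject₁) × vs (fromℕ k) ≡ vs zero × Injective _≡_ _≡_ es ×
      (∀ i → S (es i)) × (∀ i → Joins G (es i) (vs (inject₁ i)) (vs (suc i)))

    IsCycle? : ∀ k vs es → Dec (IsCycle k vs es)
    IsCycle? k vs es = injective? (vs ∘ inject₁) ×-dec vs (fromℕ k) ≟ vs zero ×-dec injective? es
      ×-dec all? (S? ∘ es) ×-dec all? (λ i → Joins? (es i) (vs (inject₁ i)) (vs (suc i)))

    IsCycle-respects-vs : ∀ {k} es → (λ vs → IsCycle k vs es) Respects _≗_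
    IsCycle-respects-vs es v≗w (inj , closed , es-inj , inS , joins) =
      (λ p → inj (trans (v≗w _) (trans p (sym (v≗w _))))) , trans (sym (v≗w _)) (trans closed (v≗w _)) ,
      es-inj , inS , λ i → subst₂ (Joins G (es i)) (v≗w _) (v≗w _) (joins i)

    IsCycle-respects-es : ∀ {k} vs → IsCycle k vs Respects _≗_
    IsCycle-respects-es vs e≗f (inj , closed , es-inj , inS , joins) =
      inj , closed , (λ p → es-inj (trans (e≗f _) (trans p (sym (e≗f _))))) ,
      (λ i → subst S (e≗f i) (inS i)) , λ i → subst (λ e → Joins G e _ _) (e≗f i) (joins i)

    CycleOfLength : ℕ → Set
    CycleOfLength k = 2 ≤ k × ∃ λ vs → ∃ λ es → IsCycle k vs es

    CycleOfLength? : Decidable CycleOfLength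
    CycleOfLength? k = 2 ≤? k ×-dec ∃-function? (λ v≗w (es , c) → es , IsCycle-respects-vs es v≗w c)
      (λ vs → ∃-function? (IsCycle-respects-es vs) (IsCycle? k vs))

  -- A cycle visits k distinct vertices, so only lengths k ≤ n G need to be searched.
  Cycle? : Dec (Cycle G S)
  Cycle? = map′
    (λ (k , _ , k≥2 , vs , es , inj , closed , es-inj , inS , joins) → record
      { k = k ; k≥2 = k≥2 ; vs = vs ; es = es ; vsInj = inj ; closed = closed
      ; esInj = es-inj ; esIn = inS ; esJoin = joins })
    (λ C → let open Cycle C in
      k , s≤s (injective⇒≤ vsInj) , k≥2 , vs , es , (λ {x y} → vsInj) , closed , (λ {x y} → esInj) , esIn , esJoin)
    (anyUpTo? CycleOfLength? (suc (n G)))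

module _ (G : Multigraph) {k : ℕ} where

  private
    ClassForest-respects : ∀ i → (λ (c : Colouring G k) → ClassForest G c i) Respects _≗_
    ClassForest-respects i c≗d forest C = forest (Cycle-map (λ {e} de≡i → trans (c≗d e) de≡i) C)

    classDegree-respects : ∀ i v {c d : Colouring G k} → c ≗ d → classDegree G c i v ≡ classDegree G d i v
    classDegree-respects i v {c} {d} c≗d = begin
      classDegree G c i v                    ≡⟨ classDegree≡subDegree G c i v ⟩
      subDegree G (λ e → ⌊ c e ≟ i ⌋) v      ≡⟨ sum-cong-≗ (λ e → cong (λ x → fromBool (⌊ x ≟ i ⌋ ∧ incidentᵇ G e v)) (c≗d e)) ⟩
      subDegree G (λ e → ⌊ d e ≟ i ⌋) v      ≡⟨ classDegree≡subDegree G d i v ⟨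
      classDegree G d i v                    ∎
      where open ≡-Reasoning

    ClassForest? : ∀ (c : Colouring G k) i → Dec (ClassForest G c i)
    ClassForest? c i = ¬? (Cycle? G (λ e → c e ≟ i))

  ForestColouring? : Dec (ForestColouring G k)
  ForestColouring? = ∃-function? (λ c≗d forests i → ClassForest-respects i c≗d (forests i))
                                 (λ c → all? (ClassForest? c))

  DegForestColouring? : ∀ t → Dec (DegForestColouring t G k)
  DegForestColouring? t = ∃-function?
    (λ c≗d valid i → ClassForest-respects i c≗d (proj₁ (valid i)) ,
                     λ v → subst (_≤ t) (classDegree-respects i v c≗d) (proj₂ (valid i) v))
    (λ c → all? λ i → ClassForest? c i ×-dec all? λ v → classDegree G c i v ≤? t)

-- The triangle with pendant leaves

module TriangleWithPendants (r s : ℕ) where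

  vertices : ℕ
  vertices = 3 + 3 * r

  hub : Fin 3 → Fin vertices
  hub j = j ↑ˡ (3 * r)

  leaf : Fin 3 → Fin r → Fin vertices
  leaf j x = 3 ↑ʳ combine j x

  next : Fin 3 → Fin 3
  next 0F = 1F
  next 1F = 2F
  next 2F = 0F

  data Edge : Set where
    triangle : Fin 3 → Fin s → Edge
    pendant  : Fin 3 → Fin r → Fin (s + s) → Edge

  endpoints : Edge → Fin vertices × Fin vertices
  endpoints (triangle b _)  = hub b , hub (next b)
  endpoints (pendant j x _) = hub j , leaf j x

  edges : ℕ
  edges = 3 * s + 3 * r * (s + s)

  private
    toSum : Edge → Fin (3 * s) ⊎ Fin (3 * r * (s + s))
    toSum (triangle b c)  = inj₁ (combine b c)
    toSum (pendant j x c) = inj₂ (combine (combine j x) c)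

    fromSum : Fin (3 * s) ⊎ Fin (3 * r * (s + s)) → Edge
    fromSum (inj₁ i) = uncurry triangle (remQuot s i)
    fromSum (inj₂ i) = uncurry (uncurry pendant ∘ remQuot r) (remQuot (s + s) i)

    fromSum-toSum : ∀ ed → fromSum (toSum ed) ≡ ed
    fromSum-toSum (triangle b c) = cong (uncurry triangle) (remQuot-combine b c)
    fromSum-toSum (pendant j x c) = trans (cong (uncurry (uncurry pendant ∘ remQuot r)) (remQuot-combine (combine j x) c))
                                          (cong (λ jx → uncurry pendant jx c) (remQuot-combine j x))

    toSum-fromSum : ∀ i → toSum (fromSum i) ≡ i
    toSum-fromSum (inj₁ i) = cong inj₁ (combine-remQuot s i)
    toSum-fromSum (inj₂ i) = cong inj₂ (trans (cong (λ jx → combine jx c) (combine-remQuot {3} r jx))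
                                              (combine-remQuot {3 * r} (s + s) i))
      where
      jx = proj₁ (remQuot {3 * r} (s + s) i)
      c  = proj₂ (remQuot {3 * r} (s + s) i)

  encode : Edge → Fin edges
  encode = join (3 * s) _ ∘ toSum

  decode : Fin edges → Edge
  decode = fromSum ∘ splitAt (3 * s)

  decode-encode : ∀ ed → decode (encode ed) ≡ ed
  decode-encode ed = trans (cong fromSum (splitAt-join (3 * s) _ (toSum ed))) (fromSum-toSum ed)

  encode-decode : ∀ e → encode (decode e) ≡ e
  encode-decode e = trans (cong (join (3 * s) _) (toSum-fromSum (splitAt (3 * s) e))) (join-splitAt (3 * s) _ e)

  decode-injective : ∀ {e e′} → decode e ≡ decode e′ → e ≡ e′
  decode-injective {e} {e′} same = trans (sym (encode-decode e)) (trans (cong encode same) (encode-decode e′))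

  encode-injective : ∀ {ed ed′} → encode ed ≡ encode ed′ → ed ≡ ed′
  encode-injective {ed} {ed′} same = trans (sym (decode-encode ed)) (trans (cong decode same) (decode-encode ed′))

  endpoints-distinct : ∀ ed → proj₁ (endpoints ed) ≢ proj₂ (endpoints ed)
  endpoints-distinct (triangle 0F _) ()
  endpoints-distinct (triangle 1F _) ()
  endpoints-distinct (triangle 2F _) ()
  endpoints-distinct (pendant 0F _ _) ()
  endpoints-distinct (pendant 1F _ _) ()
  endpoints-distinct (pendant 2F _ _) ()

  graph : Multigraph
  graph = record { n = vertices ; m = edges ; ends = endpoints ∘ decode ; noLoop = endpoints-distinct ∘ decode }

  ends-encode : ∀ ed → ends graph (encode ed) ≡ endpoints ed
  ends-encode ed = cong endpoints (decode-encode ed)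

  edgeSum : (Edge → ℕ) → ℕ
  edgeSum w = ∑[ b < 3 ] ∑[ c < s ] w (triangle b c) + ∑[ j < 3 ] ∑[ x < r ] ∑[ c < s + s ] w (pendant j x c)

  edgeSum-cong : ∀ {w w′ : Edge → ℕ} → (∀ ed → w ed ≡ w′ ed) → edgeSum w ≡ edgeSum w′
  edgeSum-cong w≗w′ = cong₂ _+_ (sum-cong-≗ λ b → sum-cong-≗ λ c → w≗w′ (triangle b c))
                                (sum-cong-≗ λ j → sum-cong-≗ λ x → sum-cong-≗ λ c → w≗w′ (pendant j x c))

  ∑-edges : ∀ (w : Fin edges → ℕ) → sum w ≡ edgeSum (w ∘ encode)
  ∑-edges w = trans (∑-↑ (3 * s) (3 * r * (s + s)) w)
    (cong₂ _+_ (∑-combine 3 s _)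
               (trans (∑-combine (3 * r) (s + s) _) (∑-combine 3 r (λ jx → ∑[ c < s + s ] w (3 * s ↑ʳ combine jx c)))))

  touches : Edge → Fin vertices → Bool
  touches ed v = ⌊ proj₁ (endpoints ed) ≟ v ⌋ ∨ ⌊ proj₂ (endpoints ed) ≟ v ⌋

  subDegree-edgeSum : ∀ q v → subDegree graph q v ≡ edgeSum (λ ed → fromBool (q (encode ed) ∧ touches ed v))
  subDegree-edgeSum q v = trans (∑-edges _) (edgeSum-cong λ ed →
    cong (λ (u , w) → fromBool (q (encode ed) ∧ (⌊ u ≟ v ⌋ ∨ ⌊ w ≟ v ⌋))) (ends-encode ed))

  adjacent : Fin 3 → Fin 3 → Bool
  adjacent b j = ⌊ b ≟ j ⌋ ∨ ⌊ next b ≟ j ⌋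

  meetsHub : Edge → Fin 3 → Bool
  meetsHub (triangle b _)  j = adjacent b j
  meetsHub (pendant i _ _) j = ⌊ i ≟ j ⌋

  meetsLeaf : Edge → Fin 3 → Fin r → Bool
  meetsLeaf (triangle _ _)  j x = false
  meetsLeaf (pendant i y _) j x = ⌊ combine i y ≟ combine j x ⌋

  private
    hub-≟-hub : ∀ i j → ⌊ hub i ≟ hub j ⌋ ≡ ⌊ i ≟ j ⌋
    hub-≟-hub = ⌊≟⌋-injective (λ {i} {j} → ↑ˡ-injective (3 * r) i j)

    leaf-≟-leaf : ∀ i y j x → ⌊ leaf i y ≟ leaf j x ⌋ ≡ ⌊ combine i y ≟ combine j x ⌋
    leaf-≟-leaf i y j x = ⌊≟⌋-injective (λ {a} {b} → ↑ʳ-injective 3 a b) (combine i y) (combine j x)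

    leaf-≟-hub : ∀ i y j → ⌊ leaf i y ≟ hub j ⌋ ≡ false
    leaf-≟-hub i y 0F = refl
    leaf-≟-hub i y 1F = refl
    leaf-≟-hub i y 2F = refl

    hub-≟-leaf : ∀ i j x → ⌊ hub i ≟ leaf j x ⌋ ≡ false
    hub-≟-leaf 0F j x = refl
    hub-≟-leaf 1F j x = refl
    hub-≟-leaf 2F j x = refl

  touches-hub : ∀ ed j → touches ed (hub j) ≡ meetsHub ed j
  touches-hub (triangle b _)  j = cong₂ _∨_ (hub-≟-hub b j) (hub-≟-hub (next b) j)
  touches-hub (pendant i y _) j = trans (cong₂ _∨_ (hub-≟-hub i j) (leaf-≟-hub i y j)) (∨-identityʳ _)

  touches-leaf : ∀ ed j x → touches ed (leaf j x) ≡ meetsLeaf ed j x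
  touches-leaf (triangle b _)  j x = cong₂ _∨_ (hub-≟-leaf b j x) (hub-≟-leaf (next b) j x)
  touches-leaf (pendant i y _) j x = trans (cong (_∨ ⌊ leaf i y ≟ leaf j x ⌋) (hub-≟-leaf i j x)) (leaf-≟-leaf i y j x)

  module _ (q : Fin edges → Bool) where

    triangleCopies : Fin 3 → ℕ
    triangleCopies b = count (λ c → q (encode (triangle b c)))

    pendantCopies : Fin 3 → Fin r → ℕ
    pendantCopies j x = count (λ c → q (encode (pendant j x c)))

    pendantsAt : Fin 3 → ℕ
    pendantsAt j = ∑[ x < r ] pendantCopies j x

    subDegree-hub : ∀ j → subDegree graph q (hub j) ≡
                          ∑[ b < 3 ] (fromBool (adjacent b j) * triangleCopies b) + pendantsAt j
    subDegree-hub j = begin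
      subDegree graph q (hub j)
        ≡⟨ subDegree-edgeSum q (hub j) ⟩
      edgeSum (λ ed → fromBool (q (encode ed) ∧ touches ed (hub j)))
        ≡⟨ edgeSum-cong (λ ed → cong (λ β → fromBool (q (encode ed) ∧ β)) (touches-hub ed j)) ⟩
      edgeSum (λ ed → fromBool (q (encode ed) ∧ meetsHub ed j))
        ≡⟨ cong₂ _+_ (sum-cong-≗ λ b → count-∧ (λ c → q (encode (triangle b c))) (adjacent b j)) pendant-part ⟩
      ∑[ b < 3 ] (fromBool (adjacent b j) * triangleCopies b) + pendantsAt j ∎
      where
      open ≡-Reasoning
      pendant-part : ∑[ i < 3 ] ∑[ x < r ] count (λ c → q (encode (pendant i x c)) ∧ ⌊ i ≟ j ⌋) ≡ pendantsAt j
      pendant-part = begin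
        ∑[ i < 3 ] ∑[ x < r ] count (λ c → q (encode (pendant i x c)) ∧ ⌊ i ≟ j ⌋)
          ≡⟨ sum-cong-≗ (λ i → sum-cong-≗ λ x → count-∧ (λ c → q (encode (pendant i x c))) ⌊ i ≟ j ⌋) ⟩
        ∑[ i < 3 ] ∑[ x < r ] (fromBool ⌊ i ≟ j ⌋ * pendantCopies i x)
          ≡⟨ sum-cong-≗ (λ i → *-distribˡ-sum (fromBool ⌊ i ≟ j ⌋) (pendantCopies i)) ⟨
        ∑[ i < 3 ] (fromBool ⌊ i ≟ j ⌋ * pendantsAt i)
          ≡⟨ ∑-δ j pendantsAt ⟩
        pendantsAt j ∎

  each-hub-on-two-triangle-edges : ∀ j → ∑[ b < 3 ] fromBool (adjacent b j) ≡ 2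
  each-hub-on-two-triangle-edges 0F = refl
  each-hub-on-two-triangle-edges 1F = refl
  each-hub-on-two-triangle-edges 2F = refl

  each-triangle-edge-on-two-hubs : ∀ b → ∑[ j < 3 ] fromBool (adjacent b j) ≡ 2
  each-triangle-edge-on-two-hubs 0F = refl
  each-triangle-edge-on-two-hubs 1F = refl
  each-triangle-edge-on-two-hubs 2F = refl

  degree-hub : ∀ j → degree graph (hub j) ≡ (s + s) * suc r
  degree-hub j = begin
    degree graph (hub j)
      ≡⟨ degree≡subDegree graph (hub j) ⟩
    subDegree graph everyEdge (hub j)
      ≡⟨ subDegree-hub everyEdge j ⟩
    ∑[ b < 3 ] (fromBool (adjacent b j) * triangleCopies everyEdge b) + pendantsAt everyEdge j
      ≡⟨ cong₂ _+_ (sum-cong-≗ λ b → cong (fromBool (adjacent b j) *_) (count-true s))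
                   (trans (sum-cong-≗ {r} {pendantCopies everyEdge j} λ x → count-true (s + s)) (∑-const r (s + s))) ⟩
    ∑[ b < 3 ] (fromBool (adjacent b j) * s) + r * (s + s)
      ≡⟨ cong (_+ r * (s + s)) (*-distribʳ-sum s (λ b → fromBool (adjacent b j))) ⟨
    (∑[ b < 3 ] fromBool (adjacent b j)) * s + r * (s + s)
      ≡⟨ cong (λ a → a * s + r * (s + s)) (each-hub-on-two-triangle-edges j) ⟩
    2 * s + r * (s + s)
      ≡⟨ rearrange r s ⟩
    (s + s) * suc r ∎
    where
    open ≡-Reasoning
    rearrange : ∀ r s → 2 * s + r * (s + s) ≡ (s + s) * suc r
    rearrange = solve-∀
    everyEdge : Fin edges → Bool
    everyEdge _ = true

  degree-leaf : ∀ j x → degree graph (leaf j x) ≡ s + s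
  degree-leaf j x = begin
    degree graph (leaf j x)
      ≡⟨ trans (degree≡subDegree graph (leaf j x)) (subDegree-edgeSum _ (leaf j x)) ⟩
    edgeSum (λ ed → fromBool (touches ed (leaf j x)))
      ≡⟨ edgeSum-cong (λ ed → cong fromBool (touches-leaf ed j x)) ⟩
    edgeSum (λ ed → fromBool (meetsLeaf ed j x))
      ≡⟨ cong₂ _+_ no-triangle-edges (sum-cong-≗ {3} λ i → sum-cong-≗ {r} λ y → copies i y) ⟩
    ∑[ i < 3 ] ∑[ y < r ] (fromBool ⌊ combine i y ≟ combine j x ⌋ * (s + s))
      ≡⟨ ∑-combine 3 r (λ w → fromBool ⌊ w ≟ combine j x ⌋ * (s + s)) ⟨
    ∑[ w < 3 * r ] (fromBool ⌊ w ≟ combine j x ⌋ * (s + s))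
      ≡⟨ ∑-δ (combine j x) (λ _ → s + s) ⟩
    s + s ∎
    where
    open ≡-Reasoning
    no-triangle-edges : ∑[ b < 3 ] ∑[ c < s ] 0 ≡ 0
    no-triangle-edges = trans (sum-cong-≗ {3} λ _ → ∑-zero s) (∑-zero 3)
    copies : ∀ i y → let δ = fromBool ⌊ combine i y ≟ combine j x ⌋ in ∑[ c < s + s ] δ ≡ δ * (s + s)
    copies i y = trans (∑-const (s + s) _) (*-comm (s + s) _)

  triangle-handshake : ∀ q → ∑[ j < 3 ] subDegree graph q (hub j) ≡
                             2 * ∑[ b < 3 ] triangleCopies q b + ∑[ j < 3 ] pendantsAt q j
  triangle-handshake q = begin
    ∑[ j < 3 ] subDegree graph q (hub j)
      ≡⟨ sum-cong-≗ (subDegree-hub q) ⟩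
    ∑[ j < 3 ] (∑[ b < 3 ] (fromBool (adjacent b j) * τ b) + pendantsAt q j)
      ≡⟨ ∑-distrib-+ (λ j → ∑[ b < 3 ] (fromBool (adjacent b j) * τ b)) (pendantsAt q) ⟩
    ∑[ j < 3 ] ∑[ b < 3 ] (fromBool (adjacent b j) * τ b) + P
      ≡⟨ cong (_+ P) (∑-comm (λ j b → fromBool (adjacent b j) * τ b)) ⟩
    ∑[ b < 3 ] ∑[ j < 3 ] (fromBool (adjacent b j) * τ b) + P
      ≡⟨ cong (_+ P) (sum-cong-≗ λ b → *-distribʳ-sum (τ b) (λ j → fromBool (adjacent b j))) ⟨
    ∑[ b < 3 ] ((∑[ j < 3 ] fromBool (adjacent b j)) * τ b) + P
      ≡⟨ cong (_+ P) (sum-cong-≗ λ b → cong (_* τ b) (each-triangle-edge-on-two-hubs b)) ⟩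
    ∑[ b < 3 ] (2 * τ b) + P
      ≡⟨ cong (_+ P) (*-distribˡ-sum 2 τ) ⟨
    2 * ∑[ b < 3 ] τ b + ∑[ j < 3 ] pendantsAt q j ∎
    where
    open ≡-Reasoning
    τ = triangleCopies q
    P = ∑[ j < 3 ] pendantsAt q j

  -- Class c ↑ˡ s is the path hub 0 – hub 1 – hub 2 and class s ↑ʳ c the side hub 2 – hub 0,
  -- each together with one copy of every pendant edge.
  colour : Edge → Fin (s + s)
  colour (triangle 0F c) = c ↑ˡ s
  colour (triangle 1F c) = c ↑ˡ s
  colour (triangle 2F c) = s ↑ʳ c
  colour (pendant _ _ c) = c

  potential : Fin vertices → ℕ
  potential 0F = 1
  potential 1F = 2
  potential 2F = 3
  potential (suc (suc (suc _))) = 0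

  lowerEnd upperEnd : Edge → Fin vertices
  lowerEnd (triangle 0F _) = hub 0F
  lowerEnd (triangle 1F _) = hub 1F
  lowerEnd (triangle 2F _) = hub 0F
  lowerEnd (pendant j x _) = leaf j x
  upperEnd (triangle 0F _) = hub 1F
  upperEnd (triangle 1F _) = hub 2F
  upperEnd (triangle 2F _) = hub 2F
  upperEnd (pendant j _ _) = hub j

  orientation : ∀ ed → (endpoints ed ≡ (lowerEnd ed , upperEnd ed)) ⊎ (endpoints ed ≡ (upperEnd ed , lowerEnd ed))
  orientation (triangle 0F _) = inj₁ refl
  orientation (triangle 1F _) = inj₁ refl
  orientation (triangle 2F _) = inj₂ refl
  orientation (pendant _ _ _) = inj₂ refl

  potential-ascends : ∀ ed → potential (lowerEnd ed) < potential (upperEnd ed)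
  potential-ascends (triangle 0F _)  = s≤s (s≤s z≤n)
  potential-ascends (triangle 1F _)  = s≤s (s≤s (s≤s z≤n))
  potential-ascends (triangle 2F _)  = s≤s (s≤s z≤n)
  potential-ascends (pendant 0F _ _) = s≤s z≤n
  potential-ascends (pendant 1F _ _) = s≤s z≤n
  potential-ascends (pendant 2F _ _) = s≤s z≤n

  reconstruct : Fin (s + s) → Fin vertices → Maybe Edge
  reconstruct k 0F = just ([ triangle 0F , triangle 2F ]′ (splitAt s k))
  reconstruct k 1F = [ just ∘ triangle 1F , const nothing ]′ (splitAt s k)
  reconstruct k 2F = nothing
  reconstruct k (suc (suc (suc w))) = just (uncurry pendant (remQuot r w) k)

  reconstruct-colour-lowerEnd : ∀ ed → reconstruct (colour ed) (lowerEnd ed) ≡ just ed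
  reconstruct-colour-lowerEnd (triangle 0F c) = cong (just ∘ [ triangle 0F , triangle 2F ]′) (splitAt-↑ˡ s c s)
  reconstruct-colour-lowerEnd (triangle 1F c) = cong [ just ∘ triangle 1F , const nothing ]′ (splitAt-↑ˡ s c s)
  reconstruct-colour-lowerEnd (triangle 2F c) = cong (just ∘ [ triangle 0F , triangle 2F ]′) (splitAt-↑ʳ s s c)
  reconstruct-colour-lowerEnd (pendant j x c) = cong (λ jx → just (uncurry pendant jx c)) (remQuot-combine j x)

  colour-lowerEnd-injective : ∀ {ed ed′} → colour ed ≡ colour ed′ → lowerEnd ed ≡ lowerEnd ed′ → ed ≡ ed′
  colour-lowerEnd-injective {ed} {ed′} same-colour same-lower = just-injective (begin
    just ed                                  ≡⟨ reconstruct-colour-lowerEnd ed ⟨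
    reconstruct (colour ed) (lowerEnd ed)    ≡⟨ cong₂ reconstruct same-colour same-lower ⟩
    reconstruct (colour ed′) (lowerEnd ed′)  ≡⟨ reconstruct-colour-lowerEnd ed′ ⟩
    just ed′                                 ∎)
    where open ≡-Reasoning

  forestColouring : ForestColouring graph (s + s)
  forestColouring = colour ∘ decode , λ i →
    potential⇒acyclic graph potential (lowerEnd ∘ decode) (upperEnd ∘ decode) (orientation ∘ decode)
      (potential-ascends ∘ decode)
      (λ colour≡i colour′≡i same-lower →
         decode-injective (colour-lowerEnd-injective (trans colour≡i (sym colour′≡i)) same-lower))

  module _ (q : Fin edges → Bool) (acyclic : ¬ Cycle graph (λ e → q e ≡ true))
           (degree-bounded : ∀ v → subDegree graph q v ≤ suc r) where

    private
      at-most-one-copy : ∀ {k} (copy : Fin k → Edge) → (∀ {c c′} → copy c ≡ copy c′ → c ≡ c′) →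
                         (∀ c c′ → endpoints (copy c) ≡ endpoints (copy c′)) → count (λ c → q (encode (copy c))) ≤ 1
      at-most-one-copy copy copy-injective parallel = count≤1 _ unique
        where
        unique : ∀ {c c′} → q (encode (copy c)) ≡ true → q (encode (copy c′)) ≡ true → c ≡ c′
        unique {c} {c′} chosen chosen′ with c ≟ c′
        ... | yes c≡c′ = c≡c′
        ... | no c≢c′  = ⊥-elim (acyclic (parallel⇒Cycle graph
                           (trans (ends-encode (copy c)) (trans (parallel c c′) (sym (ends-encode (copy c′)))))
                           (c≢c′ ∘ copy-injective ∘ encode-injective) chosen chosen′))

      triangleCopies≤1 : ∀ b → triangleCopies q b ≤ 1
      triangleCopies≤1 b = at-most-one-copy (triangle b) (λ { refl → refl }) (λ _ _ → refl)

      pendantsAt≤r : ∀ j → pendantsAt q j ≤ r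
      pendantsAt≤r j = ≤-trans (∑-mono (λ x → at-most-one-copy (pendant j x) (λ { refl → refl }) (λ _ _ → refl)))
                               (≤-reflexive (trans (∑-const r 1) (*-identityʳ r)))

      triangle-not-full : ¬ (0 < triangleCopies q 0F × 0 < triangleCopies q 1F × 0 < triangleCopies q 2F)
      triangle-not-full (pos₀ , pos₁ , pos₂)
        with c₀ , chosen₀ ← 0<count⇒∃ _ pos₀ | c₁ , chosen₁ ← 0<count⇒∃ _ pos₁ | c₂ , chosen₂ ← 0<count⇒∃ _ pos₂
        = acyclic (triangle⇒Cycle graph (ends-encode (triangle 0F c₀)) (ends-encode (triangle 1F c₁))
                                        (ends-encode (triangle 2F c₂)) chosen₀ chosen₁ chosen₂)

      hub-degrees : 2 * ∑[ b < 3 ] triangleCopies q b + ∑[ j < 3 ] pendantsAt q j ≤ 3 + 3 * r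
      hub-degrees = begin
        2 * ∑[ b < 3 ] triangleCopies q b + ∑[ j < 3 ] pendantsAt q j ≡⟨ triangle-handshake q ⟨
        ∑[ j < 3 ] subDegree graph q (hub j)                          ≤⟨ ∑-mono (degree-bounded ∘ hub) ⟩
        ∑[ j < 3 ] suc r                                             ≡⟨ trans (∑-const 3 (suc r)) (*-suc 3 r) ⟩
        3 + 3 * r                                                    ∎
        where open ≤-Reasoning

    forest-size : count q ≤ suc (3 * r)
    forest-size = subst (_≤ suc (3 * r)) (sym (∑-edges (fromBool ∘ q)))
      (edge-budget
        (at-most-two (triangleCopies≤1 0F) (triangleCopies≤1 1F) (triangleCopies≤1 2F) triangle-not-full)
        (≤-trans (∑-mono pendantsAt≤r) (≤-reflexive (∑-const 3 r)))
        hub-degrees)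

  degree≤ : ∀ v → degree graph v ≤ (s + s) * suc r
  degree≤ 0F = ≤-reflexive (degree-hub 0F)
  degree≤ 1F = ≤-reflexive (degree-hub 1F)
  degree≤ 2F = ≤-reflexive (degree-hub 2F)
  degree≤ (suc (suc (suc w))) = subst (λ v → degree graph v ≤ (s + s) * suc r) leaf≡
    (≤-trans (≤-reflexive (degree-leaf j x)) (m≤m*n (s + s) (suc r)))
    where
    j = proj₁ (remQuot {3} r w)
    x = proj₂ (remQuot {3} r w)
    leaf≡ : leaf j x ≡ suc (suc (suc w))
    leaf≡ = cong (3 ↑ʳ_) (combine-remQuot {3} r w)

  Δ-graph : Δ (suc r) graph ≡ s + s
  Δ-graph = ≤-antisym (Δ-lub (suc r) graph (λ v → ceilDiv≤ r (degree≤ v)))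
    (≤-trans (≤ceilDiv r (≤-reflexive (sym (degree-hub 0F)))) (ceilDiv-degree≤Δ (suc r) graph (hub 0F)))

  edges≤colours*[1+3r] : ∀ {K} → DegForestColouring (suc r) graph K → edges ≤ K * suc (3 * r)
  edges≤colours*[1+3r] (c , valid) = edges≤colours*classSize graph c λ i →
    forest-size (λ e → ⌊ c e ≟ i ⌋) (proj₁ (valid i) ∘ Cycle-map ⌊≟⌋⇒≡)
      (λ v → subst (_≤ suc r) (classDegree≡subDegree graph c i v) (proj₂ (valid i) v))

module _ (r N : ℕ) where

  private
    s = suc N
    open TriangleWithPendants r s

  arboricity : Σ ℕ (IsArboricity graph)
  arboricity = minimum (λ k → ForestColouring? graph {k}) forestColouring

  degArboricity : Σ ℕ (IsDegArboricity (suc r) graph)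
  degArboricity = minimum (λ k → DegForestColouring? graph {k} (suc r)) (singletonColouring graph (s≤s z≤n))

  Δ⊔a≡2s : Δ (suc r) graph ⊔ proj₁ arboricity ≡ s + s
  Δ⊔a≡2s = trans (cong (_⊔ proj₁ arboricity) Δ-graph)
                 (m≥n⇒m⊔n≡m (proj₂ (proj₂ arboricity) (s + s) forestColouring))

  ratio : (3 + 6 * r) * (s + s) ≤ (2 + 6 * r) * proj₁ degArboricity
  ratio = begin
    (3 + 6 * r) * (s + s)               ≡⟨ double-edges r s ⟩
    edges + edges                       ≤⟨ +-mono-≤ bound bound ⟩
    aₜ * suc (3 * r) + aₜ * suc (3 * r) ≡⟨ double-colours r aₜ ⟩
    (2 + 6 * r) * aₜ                    ∎
    where
    open ≤-Reasoning
    aₜ = proj₁ degArboricity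
    bound = edges≤colours*[1+3r] (proj₁ (proj₂ degArboricity))
    double-edges : ∀ r s → (3 + 6 * r) * (s + s) ≡ (3 * s + 3 * r * (s + s)) + (3 * s + 3 * r * (s + s))
    double-edges = solve-∀
    double-colours : ∀ r a → a * suc (3 * r) + a * suc (3 * r) ≡ (2 + 6 * r) * a
    double-colours = solve-∀

theorem3 : (t : ℕ) → 2 ≤ t →
    Σ ℕ λ p → Σ ℕ λ q → 1 ≤ q × q < p ×
      ((N : ℕ) → Σ ℕ λ d → N ≤ d × 2 ≤ d ×
        Σ Multigraph λ G → Σ ℕ λ a → Σ ℕ λ at →
          IsArboricity G a × IsDegArboricity t G at ×
          Δ t G ⊔ a ≡ d × p * d ≤ q * at)
theorem3 (suc r) _ = 3 + 6 * r , 2 + 6 * r , s≤s z≤n , ≤-refl , λ N →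
  let open TriangleWithPendants r (suc N)
      (a , a-min)   = arboricity r N
      (aₜ , aₜ-min) = degArboricity r N
      d≡2s          = sym (Δ⊔a≡2s r N)
  in Δ (suc r) graph ⊔ a
   , subst (N ≤_) d≡2s (≤-trans (n≤1+n N) (m≤m+n (suc N) (suc N)))
   , subst (2 ≤_) d≡2s (s≤s (≤-trans (s≤s z≤n) (m≤n+m (suc N) N)))
   , graph , a , aₜ , a-min , aₜ-min , refl
   , subst (λ d → (3 + 6 * r) * d ≤ (2 + 6 * r) * aₜ) d≡2s (ratio r N)
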